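{- Let $m$ be a prime, $i\in\{1,2,\ldots,m-1\}$ and $k\geqslant 2$ an integer, and let $\mathcal{M}=(m^{j-1})_{j\in\mathbb{N}_+}$. Then the congruence $p_\mathcal{M}(n,k)\equiv i\pmod{m}$ has exactly $m(m-1)^{k-2}$ distinct solutions $n$ modulo $m^k$ (i.e. exactly $m(m-1)^{k-2}$ solutions $n\in\{0,1,\ldots,m^k-1\}$). If $k=1$, then $p_\mathcal{M}(n,1)=1$ for all $n\in\mathbb{N}$.
   Context: $\mathbb{N}=\{0,1,2,\ldots\}$. $p_\mathcal{M}(n,k)$ is the number of tuples $(x_1,\ldots,x_k)\in\mathbb{N}^k$ with $x_1+mx_2+m^2x_3+\cdots+m^{k-1}x_k=n$, i.e. $\sum_{n\ge0}p_\mathcal{M}(n,k)x^n=\prod_{i=0}^{k-1}(1-x^{m^i})^{ -1}$. -}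

module Defs where

open import Data.Nat using (ℕ; zero; suc; _+_; _*_; _∸_; _^_; _≤?_; _≟_; _%_; NonZero)
open import Data.List using (List; upTo; map; filter; length)
open import Data.Nat.ListAction using (sum)
open import Relation.Nullary.Decidable using (does)
open import Data.Bool using (if_then_else_)

-- pM m n k = number of tuples (x₁,…,x_k) ∈ ℕ^k with
--   x₁ + m x₂ + m² x₃ + ⋯ + m^(k-1) x_k = n.
-- Defined by enumerating the last coordinate x_k ∈ {0,…,n}
-- (for m ≥ 1 any admissible x_k satisfies x_k ≤ m^(k-1) x_k ≤ n, so this is
--  the exact tuple count; the statement only uses prime m).
pM : ℕ → ℕ → ℕ → ℕ
pM m n zero = if does (n ≟ 0) then 1 else 0
pM m n (suc k) =
  sum (map (λ x → if does (m ^ k * x ≤? n) then pM m (n ∸ m ^ k * x) k else 0)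
           (upTo (suc n)))

numSolutions : (m : ℕ) .{{_ : NonZero m}} → ℕ → ℕ → ℕ
numSolutions m i k =
  length (filter (λ n → (pM m n k % m) ≟ i) (upTo (m ^ k)))

-- Write Q_k(n) = ∏_{j=1..k} (⌊n/m^j⌋ + 1).  Modulo m, Q_k(n) only sees the base-m digits of n in
-- positions 1..k, so it is unchanged by adding multiples of m^(k+1).  In the defining recursion
-- pM(n, k+2) = Σ_{m^(k+1) x ≤ n} pM(n − m^(k+1) x, k+1), if pM(·, k+1) ≡ Q_k then every summand is
-- ≡ Q_k(n), and there are ⌊n/m^(k+1)⌋ + 1 of them; so inductively pM(n, k+1) ≡ Q_k(n) (mod m).
-- Now count n < m^(k+1) with Q_k(n) ≡ i by the leading digit d of n, which contributes the factor d + 1: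
-- the digit d = m − 1 gives no solution (i ≢ 0), and for each other digit d + 1 is a unit mod the prime m,
-- so the count is that of the previous level for the residue i/(d + 1).  The last digit of n is free,
-- which accounts for the factor m.

module Submission where

open import Defs
open import Data.Nat using (ℕ; suc; _*_; _∸_; _^_; _≤_; _<_; NonZero)
open import Data.Nat.Primality using (Prime; prime⇒nonZero)
open import Data.Product using (_×_)
open import Relation.Binary.PropositionalEquality using (_≡_)

open import Data.Nat using (zero; _+_; _⊓_; _/_; _%_; _≤?_; _<?_; _≟_; s≤s)
open import Data.Nat.Properties
open import Algebra.Properties.CommutativeSemigroup *-commutativeSemigroup using (x∙yz≈y∙xz)
open import Data.Nat.DivMod hiding (_mod_)
open import Data.Nat.Divisibility using (divides-refl)
open import Data.Nat.Coprimality using (coprime-Bézout; prime⇒coprime)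
open import Data.Nat.GCD using (module Bézout)
open import Data.Nat.Primality using (prime⇒nonTrivial)
open import Data.Nat.Base using (nonTrivial⇒n>1)
open import Data.Nat.ListAction using (sum)
open import Data.Nat.ListAction.Properties using (sum-++)
open import Data.Nat.Solver using (module +-*-Solver)
open import Data.List using (upTo; map; filter; length; _++_; [_])
open import Data.List.Properties using (upTo-∷ʳ; map-++; length-++; filter-++)
open import Data.Bool using (if_then_else_)
open import Data.Product using (∃-syntax; _,_)
open import Function.Bundles using (_⇔_; mk⇔; Equivalence)
open import Relation.Nullary using (Dec; yes; no; ¬_; does; contradiction)
open import Relation.Nullary.Decidable using (dec-true; dec-false)
open import Function using (_∘_)
open import Relation.Unary using (Decidable)
open import Relation.Binary.Bundles using (Setoid)
import Relation.Binary.Reasoning.Setoid as SetoidReasoning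
open import Relation.Binary.PropositionalEquality
  using (_≢_; refl; sym; trans; cong; cong₂; subst; module ≡-Reasoning)

open Equivalence using (to; from)

∑< : ℕ → (ℕ → ℕ) → ℕ
∑< zero    f = 0
∑< (suc n) f = ∑< n f + f n

syntax ∑< n (λ x → e) = ∑[ x < n ] e

indicator : {P : Set} → Dec P → ℕ
indicator P? = if does P? then 1 else 0

count : ℕ → {P : ℕ → Set} → Decidable P → ℕ
count n P? = ∑[ x < n ] indicator (P? x)

sum-map-upTo : ∀ f n → sum (map f (upTo n)) ≡ ∑< n f
sum-map-upTo f zero    = refl
sum-map-upTo f (suc n) = begin
  sum (map f (upTo (suc n)))         ≡⟨ cong (λ xs → sum (map f xs)) (sym (upTo-∷ʳ n)) ⟩
  sum (map f (upTo n ++ [ n ]))      ≡⟨ cong sum (map-++ f (upTo n) [ n ]) ⟩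
  sum (map f (upTo n) ++ [ f n ])    ≡⟨ sum-++ (map f (upTo n)) [ f n ] ⟩
  sum (map f (upTo n)) + (f n + 0)   ≡⟨ cong₂ _+_ (sum-map-upTo f n) (+-identityʳ (f n)) ⟩
  ∑< (suc n) f                       ∎
  where open ≡-Reasoning

length-filter-upTo : ∀ {P : ℕ → Set} (P? : Decidable P) n →
                     length (filter P? (upTo n)) ≡ count n P?
length-filter-upTo P? zero    = refl
length-filter-upTo P? (suc n) = begin
  length (filter P? (upTo (suc n)))                   ≡⟨ cong (λ xs → length (filter P? xs)) (sym (upTo-∷ʳ n)) ⟩
  length (filter P? (upTo n ++ [ n ]))                ≡⟨ cong length (filter-++ P? (upTo n) [ n ]) ⟩
  length (filter P? (upTo n) ++ filter P? [ n ])      ≡⟨ length-++ (filter P? (upTo n)) ⟩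
  length (filter P? (upTo n)) + length (filter P? [ n ])
    ≡⟨ cong₂ _+_ (length-filter-upTo P? n) length-filter-singleton ⟩
  count (suc n) P?                                    ∎
  where
  open ≡-Reasoning
  length-filter-singleton : length (filter P? [ n ]) ≡ indicator (P? n)
  length-filter-singleton with P? n
  ... | yes _ = refl
  ... | no  _ = refl

∑<-cong : ∀ {f g} n → (∀ {x} → x < n → f x ≡ g x) → ∑< n f ≡ ∑< n g
∑<-cong zero    f≡g = refl
∑<-cong (suc n) f≡g = cong₂ _+_ (∑<-cong n (λ x<n → f≡g (m<n⇒m<1+n x<n))) (f≡g ≤-refl)

∑<-const : ∀ {f} c n → (∀ {x} → x < n → f x ≡ c) → ∑< n f ≡ n * c
∑<-const c zero    f≡c = refl
∑<-const {f} c (suc n) f≡c = begin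
  ∑< n f + f n ≡⟨ cong₂ _+_ (∑<-const c n (λ x<n → f≡c (m<n⇒m<1+n x<n))) (f≡c ≤-refl) ⟩
  n * c + c    ≡⟨ +-comm (n * c) c ⟩
  suc n * c    ∎
  where open ≡-Reasoning

∑<-*ˡ : ∀ c f n → ∑[ x < n ] (c * f x) ≡ c * ∑< n f
∑<-*ˡ c f zero    = sym (*-zeroʳ c)
∑<-*ˡ c f (suc n) = trans (cong (_+ c * f n) (∑<-*ˡ c f n)) (sym (*-distribˡ-+ c (∑< n f) (f n)))

∑<-+ : ∀ f a b → ∑< (a + b) f ≡ ∑< a f + ∑[ x < b ] f (a + x)
∑<-+ f a zero    = trans (cong (λ n → ∑< n f) (+-identityʳ a)) (sym (+-identityʳ (∑< a f)))
∑<-+ f a (suc b) = begin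
  ∑< (a + suc b) f                                ≡⟨ cong (λ n → ∑< n f) (+-suc a b) ⟩
  ∑< (a + b) f + f (a + b)                        ≡⟨ cong (_+ f (a + b)) (∑<-+ f a b) ⟩
  ∑< a f + ∑[ x < b ] f (a + x) + f (a + b)       ≡⟨ +-assoc (∑< a f) _ _ ⟩
  ∑< a f + ∑[ x < suc b ] f (a + x)               ∎
  where open ≡-Reasoning

∑<-blocks : ∀ f D B → ∑< (D * B) f ≡ ∑[ d < D ] ∑[ x < B ] f (d * B + x)
∑<-blocks f zero    B = refl
∑<-blocks f (suc D) B = begin
  ∑< (B + D * B) f                                        ≡⟨ cong (λ n → ∑< n f) (+-comm B (D * B)) ⟩
  ∑< (D * B + B) f                                        ≡⟨ ∑<-+ f (D * B) B ⟩
  ∑< (D * B) f + ∑[ x < B ] f (D * B + x)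
    ≡⟨ cong (_+ ∑[ x < B ] f (D * B + x)) (∑<-blocks f D B) ⟩
  ∑[ d < suc D ] ∑[ x < B ] f (d * B + x)                 ∎
  where open ≡-Reasoning

∑<-if : ∀ {P : ℕ → Set} (P? : Decidable P) c n →
        ∑[ x < n ] (if does (P? x) then c else 0) ≡ count n P? * c
∑<-if P? c zero    = refl
∑<-if P? c (suc n) with P? n
... | yes _ = trans (cong₂ _+_ (∑<-if P? c n) (sym (+-identityʳ c))) (sym (*-distribʳ-+ c (count n P?) 1))
... | no  _ = trans (cong (_+ 0) (∑<-if P? c n)) (sym (*-distribʳ-+ c (count n P?) 0))

indicator-cong : ∀ {P Q : Set} (P? : Dec P) (Q? : Dec Q) → P ⇔ Q → indicator P? ≡ indicator Q?
indicator-cong (yes _) (yes _) P⇔Q = refl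
indicator-cong (yes p) (no ¬q) P⇔Q = contradiction (to P⇔Q p) ¬q
indicator-cong (no ¬p) (yes q) P⇔Q = contradiction (from P⇔Q q) ¬p
indicator-cong (no _)  (no _)  P⇔Q = refl

count-cong : ∀ {P Q : ℕ → Set} (P? : Decidable P) (Q? : Decidable Q) n →
             (∀ {x} → x < n → P x ⇔ Q x) → count n P? ≡ count n Q?
count-cong P? Q? n P⇔Q = ∑<-cong n (λ {x} x<n → indicator-cong (P? x) (Q? x) (P⇔Q x<n))

indicator-yes : ∀ {P : Set} (P? : Dec P) → P → indicator P? ≡ 1
indicator-yes P? p = cong (if_then 1 else 0) (dec-true P? p)

indicator-no : ∀ {P : Set} (P? : Dec P) → ¬ P → indicator P? ≡ 0
indicator-no P? ¬p = cong (if_then 1 else 0) (dec-false P? ¬p)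

count-none : ∀ {P : ℕ → Set} (P? : Decidable P) n → (∀ {x} → x < n → ¬ P x) → count n P? ≡ 0
count-none P? n ¬P = trans (∑<-const 0 n (λ x<n → indicator-no (P? _) (¬P x<n))) (*-zeroʳ n)

count-< : ∀ n c → count n (_<? c) ≡ n ⊓ c
count-< zero    c = refl
count-< (suc n) c with n <? c
... | yes n<c = begin
  count n (_<? c) + indicator (n <? c)   ≡⟨ cong₂ _+_ (count-< n c) (indicator-yes (n <? c) n<c) ⟩
  n ⊓ c + 1                              ≡⟨ cong (_+ 1) (m≤n⇒m⊓n≡m (<⇒≤ n<c)) ⟩
  n + 1                                  ≡⟨ +-comm n 1 ⟩
  suc n                                  ≡⟨ m≤n⇒m⊓n≡m n<c ⟨
  suc n ⊓ c                              ∎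
  where open ≡-Reasoning
... | no  n≮c = begin
  count n (_<? c) + indicator (n <? c)   ≡⟨ cong₂ _+_ (count-< n c) (indicator-no (n <? c) n≮c) ⟩
  n ⊓ c + 0                              ≡⟨ +-identityʳ (n ⊓ c) ⟩
  n ⊓ c                                  ≡⟨ m≥n⇒m⊓n≡n (≮⇒≥ n≮c) ⟩
  c                                      ≡⟨ m≥n⇒m⊓n≡n (m≤n⇒m≤1+n (≮⇒≥ n≮c)) ⟨
  suc n ⊓ c                              ∎
  where open ≡-Reasoning

count-≟ : ∀ c n → c < n → count n (_≟ c) ≡ 1
count-≟ c (suc n) c<1+n with n ≟ c
... | yes refl = cong₂ _+_ (count-none (_≟ c) c (λ x<c x≡c → <⇒≢ x<c x≡c)) (indicator-yes (c ≟ c) refl)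
... | no  n≢c  = trans (cong₂ _+_ (count-≟ c n c<n) (indicator-no (n ≟ c) n≢c)) (+-identityʳ 1)
  where
  c<n : c < n
  c<n = ≤∧≢⇒< (≤-pred c<1+n) (n≢c ∘ sym)

*≤⇔≤/ : ∀ B {x n} .{{_ : NonZero B}} → B * x ≤ n ⇔ x ≤ n / B
*≤⇔≤/ B {x} {n} = mk⇔
  (λ Bx≤n → subst (_≤ n / B) (m*n/n≡m x B) (/-monoˡ-≤ B (subst (_≤ n) (*-comm B x) Bx≤n)))
  (λ x≤n/B → ≤-trans (*-monoʳ-≤ B x≤n/B) (subst (_≤ n) (*-comm (n / B) B) (m/n*n≤m n B)))

count-multiples-≤ : ∀ B n .{{_ : NonZero B}} → count (suc n) (λ x → B * x ≤? n) ≡ suc (n / B)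
count-multiples-≤ B n = begin
  count (suc n) (λ x → B * x ≤? n)
    ≡⟨ count-cong (λ x → B * x ≤? n) (_<? suc (n / B)) (suc n) B*x≤n⇔x<1+n/B ⟩
  count (suc n) (_<? suc (n / B))       ≡⟨ count-< (suc n) (suc (n / B)) ⟩
  suc n ⊓ suc (n / B)                   ≡⟨ m≥n⇒m⊓n≡n (s≤s (m/n≤m n B)) ⟩
  suc (n / B)                           ∎
  where
  open ≡-Reasoning
  B*x≤n⇔x<1+n/B : ∀ {x} → x < suc n → B * x ≤ n ⇔ x < suc (n / B)
  B*x≤n⇔x<1+n/B _ = mk⇔ (s≤s ∘ to (*≤⇔≤/ B)) (from (*≤⇔≤/ B) ∘ ≤-pred)

pM-1 : ∀ m n → pM m n 1 ≡ 1
pM-1 m n = begin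
  pM m n 1                                                                   ≡⟨ sum-map-upTo _ (suc n) ⟩
  ∑[ x < suc n ] (if does (1 * x ≤? n) then pM m (n ∸ 1 * x) 0 else 0)       ≡⟨ ∑<-cong (suc n) summand ⟩
  count (suc n) (_≟ n)                                                       ≡⟨ count-≟ n (suc n) ≤-refl ⟩
  1                                                                          ∎
  where
  open ≡-Reasoning
  summand : ∀ {x} → x < suc n → (if does (1 * x ≤? n) then pM m (n ∸ 1 * x) 0 else 0) ≡ indicator (x ≟ n)
  summand {x} x<1+n rewrite *-identityˡ x | dec-true (x ≤? n) (≤-pred x<1+n) =
    indicator-cong (n ∸ x ≟ 0) (x ≟ n)
      (mk⇔ (λ n∸x≡0 → ≤-antisym (≤-pred x<1+n) (m∸n≡0⇒m≤n n∸x≡0)) (λ { refl → n∸n≡0 n }))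

infix 4 _≡_mod_

-- A record rather than a definition, so that a and b can be inferred from a congruence.
record _≡_mod_ (a b m : ℕ) .{{_ : NonZero m}} : Set where
  constructor congruent
  field %-≡ : a % m ≡ b % m

open _≡_mod_ public

module _ {m : ℕ} .{{_ : NonZero m}} where

  ≡⇒≡-mod : ∀ {a b} → a ≡ b → a ≡ b mod m
  ≡⇒≡-mod a≡b = congruent (cong (_% m) a≡b)

  ≡-mod-setoid : Setoid _ _
  ≡-mod-setoid = record
    { Carrier       = ℕ
    ; _≈_           = _≡_mod m
    ; isEquivalence = record
      { refl  = congruent refl
      ; sym   = λ (congruent p) → congruent (sym p)
      ; trans = λ (congruent p) (congruent q) → congruent (trans p q)
      }
    }

  open Setoid ≡-mod-setoid public
    using () renaming (refl to ≡-mod-refl; sym to ≡-mod-sym)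

  module ≡-mod-Reasoning = SetoidReasoning ≡-mod-setoid

  +-cong-mod : ∀ {a a′ b b′} → a ≡ a′ mod m → b ≡ b′ mod m → a + b ≡ a′ + b′ mod m
  +-cong-mod {a} {a′} {b} {b′} (congruent p) (congruent q) = congruent (begin
    (a + b) % m                   ≡⟨ %-distribˡ-+ a b m ⟩
    (a % m + b % m) % m           ≡⟨ cong₂ (λ u v → (u + v) % m) p q ⟩
    (a′ % m + b′ % m) % m         ≡⟨ %-distribˡ-+ a′ b′ m ⟨
    (a′ + b′) % m                 ∎)
    where open ≡-Reasoning

  *-cong-mod : ∀ {a a′ b b′} → a ≡ a′ mod m → b ≡ b′ mod m → a * b ≡ a′ * b′ mod m
  *-cong-mod {a} {a′} {b} {b′} (congruent p) (congruent q) = congruent (begin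
    (a * b) % m                   ≡⟨ %-distribˡ-* a b m ⟩
    (a % m * (b % m)) % m         ≡⟨ cong₂ (λ u v → (u * v) % m) p q ⟩
    (a′ % m * (b′ % m)) % m       ≡⟨ %-distribˡ-* a′ b′ m ⟨
    (a′ * b′) % m                 ∎)
    where open ≡-Reasoning

  *-congˡ-mod : ∀ c {a a′} → a ≡ a′ mod m → c * a ≡ c * a′ mod m
  *-congˡ-mod c = *-cong-mod (≡-mod-refl {c})

  *-congʳ-mod : ∀ c {a a′} → a ≡ a′ mod m → a * c ≡ a′ * c mod m
  *-congʳ-mod c a≡a′ = *-cong-mod a≡a′ (≡-mod-refl {c})

  +-multiple-mod : ∀ a k → a + k * m ≡ a mod m
  +-multiple-mod a k = congruent ([m+kn]%n≡m%n a k m)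

  ∑<-cong-mod : ∀ {f g} n → (∀ {x} → x < n → f x ≡ g x mod m) → ∑< n f ≡ ∑< n g mod m
  ∑<-cong-mod zero    f≡g = ≡-mod-refl
  ∑<-cong-mod (suc n) f≡g = +-cong-mod (∑<-cong-mod n (λ x<n → f≡g (m<n⇒m<1+n x<n))) (f≡g ≤-refl)

  if-cong-mod : ∀ {P : Set} (P? : Dec P) {a b} → (P → a ≡ b mod m) →
                (if does P? then a else 0) ≡ (if does P? then b else 0) mod m
  if-cong-mod (yes p) a≡b = a≡b p
  if-cong-mod (no  _) a≡b = ≡-mod-refl

  %≡⇔≡-mod : ∀ {a i} → i < m → (a % m ≡ i) ⇔ (a ≡ i mod m)
  %≡⇔≡-mod {a} {i} i<m = mk⇔
    (λ a%m≡i → congruent (trans a%m≡i (sym (m<n⇒m%n≡m i<m))))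
    (λ (congruent a≡i) → trans a≡i (m<n⇒m%n≡m i<m))

  %≡-cong-mod : ∀ {a b i} → a ≡ b mod m → (a % m ≡ i) ⇔ (b % m ≡ i)
  %≡-cong-mod (congruent a≡b) = mk⇔ (trans (sym a≡b)) (trans a≡b)

  *-cancel-unit-mod : ∀ {u v} → u * v ≡ 1 mod m → ∀ y i → (y * u ≡ i mod m) ⇔ (y ≡ i * v mod m)
  *-cancel-unit-mod {u} {v} uv≡1 y i = mk⇔ cancel multiply
    where
    open ≡-mod-Reasoning
    cancel : y * u ≡ i mod m → y ≡ i * v mod m
    cancel yu≡i = begin
      y             ≡⟨ *-identityʳ y ⟨
      y * 1         ≈⟨ *-congˡ-mod y (≡-mod-sym uv≡1) ⟩
      y * (u * v)   ≡⟨ *-assoc y u v ⟨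
      y * u * v     ≈⟨ *-congʳ-mod v yu≡i ⟩
      i * v         ∎
    multiply : y ≡ i * v mod m → y * u ≡ i mod m
    multiply y≡iv = begin
      y * u         ≈⟨ *-congʳ-mod u y≡iv ⟩
      i * v * u     ≡⟨ trans (*-assoc i v u) (cong (i *_) (*-comm v u)) ⟩
      i * (u * v)   ≈⟨ *-congˡ-mod i uv≡1 ⟩
      i * 1         ≡⟨ *-identityʳ i ⟩
      i             ∎

∃-inverse-mod : ∀ {p} .{{_ : NonZero p}} → Prime p →
                ∀ u .{{_ : NonZero u}} → u < p → ∃[ v ] u * v ≡ 1 mod p
∃-inverse-mod {suc p₁} pp u u<p with coprime-Bézout (prime⇒coprime pp u<p)
... | Bézout.-+ x y 1+xp≡yu = y , (begin
  u * y         ≡⟨ *-comm u y ⟩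
  y * u         ≡⟨ 1+xp≡yu ⟨
  1 + x * p     ≈⟨ +-multiple-mod 1 x ⟩
  1             ∎)
  where
  open ≡-mod-Reasoning
  p : ℕ
  p = suc p₁
-- Here y u ≡ −1, so y (p − 1) inverts u.
... | Bézout.+- x y 1+yu≡xp = y * p₁ , (begin
  u * (y * p₁)                  ≈⟨ ≡-mod-sym (+-multiple-mod _ x) ⟩
  u * (y * p₁) + x * p          ≡⟨ cong (u * (y * p₁) +_) 1+yu≡xp ⟨
  u * (y * p₁) + (1 + y * u)
    ≡⟨ solve 3 (λ u y p₁ → u :* (y :* p₁) :+ (con 1 :+ y :* u) := con 1 :+ (y :* u) :* (con 1 :+ p₁)) refl u y p₁ ⟩
  1 + y * u * p                 ≈⟨ +-multiple-mod 1 (y * u) ⟩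
  1                             ∎)
  where
  open ≡-mod-Reasoning
  open +-*-Solver
  p : ℕ
  p = suc p₁

∃-quotient-mod : ∀ {p} .{{_ : NonZero p}} → Prime p → ∀ u .{{_ : NonZero u}} → u < p →
                 ∀ {i} → 1 ≤ i → i < p → ∃[ j ] 1 ≤ j × j < p × (∀ y → (y * u % p ≡ i) ⇔ (y % p ≡ j))
∃-quotient-mod {suc p₁} pp u u<p {i} 1≤i i<p with ∃-inverse-mod pp u u<p
... | v , uv≡1 = i * v % p , 1≤j , m%n<n (i * v) p , solution⇔
  where
  p : ℕ
  p = suc p₁
  solution⇔ : ∀ y → (y * u % p ≡ i) ⇔ (y % p ≡ i * v % p)
  solution⇔ y = mk⇔ (λ yu%p≡i → %-≡ (to (*-cancel-unit-mod uv≡1 y i) (to (%≡⇔≡-mod i<p) yu%p≡i)))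
                    (λ y%p≡j → from (%≡⇔≡-mod i<p) (from (*-cancel-unit-mod uv≡1 y i) (congruent y%p≡j)))
  1≤j : 1 ≤ i * v % p
  1≤j = n≢0⇒n>0 (λ j≡0 → <⇒≢ 1≤i (from (solution⇔ 0) (sym j≡0)))

[d*B+x]/B≡d : ∀ d {x} B .{{_ : NonZero B}} → x < B → (d * B + x) / B ≡ d
[d*B+x]/B≡d d {x} B x<B = begin
  (d * B + x) / B       ≡⟨ +-distrib-/-∣ˡ x (divides-refl d) ⟩
  d * B / B + x / B     ≡⟨ cong₂ _+_ (m*n/n≡m d B) (m<n⇒m/n≡0 x<B) ⟩
  d + 0                 ≡⟨ +-identityʳ d ⟩
  d                     ∎
  where open ≡-Reasoning

module _ (m₁ : ℕ) where

  private
    m : ℕ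
    m = suc m₁

  infixl 7 _/m^_

  _/m^_ : ℕ → ℕ → ℕ
  n /m^ j = _/_ n (m ^ j) {{m^n≢0 m j}}

  quotientProduct : ℕ → ℕ → ℕ
  quotientProduct zero    n = 1
  quotientProduct (suc k) n = quotientProduct k n * suc (n /m^ suc k)

  m^[1+j]*c≡m^j*[m*c] : ∀ j c → m ^ suc j * c ≡ m ^ j * (m * c)
  m^[1+j]*c≡m^j*[m*c] j c = trans (cong (_* c) (*-comm m (m ^ j))) (*-assoc (m ^ j) m c)

  /m^-shift : ∀ j n c → (n + m ^ suc j * c) /m^ j ≡ n /m^ j + m * c
  /m^-shift j n c = begin
    (n + m ^ suc j * c) / m ^ j
      ≡⟨ cong (λ t → (n + t) / m ^ j) (trans (m^[1+j]*c≡m^j*[m*c] j c) (*-comm (m ^ j) (m * c))) ⟩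
    (n + m * c * m ^ j) / m ^ j
      ≡⟨ +-distrib-/-∣ʳ n (divides-refl (m * c)) ⟩
    n / m ^ j + m * c * m ^ j / m ^ j
      ≡⟨ cong (n / m ^ j +_) (m*n/n≡m (m * c) (m ^ j)) ⟩
    n / m ^ j + m * c
      ∎
    where
    open ≡-Reasoning
    instance
      m^j≢0 : NonZero (m ^ j)
      m^j≢0 = m^n≢0 m j

  quotientProduct-shift : ∀ k n c → quotientProduct k (n + m ^ suc k * c) ≡ quotientProduct k n mod m
  quotientProduct-shift zero    n c = ≡-mod-refl
  quotientProduct-shift (suc k) n c = *-cong-mod lower-factors last-factor
    where
    open ≡-mod-Reasoning
    lower-factors : quotientProduct k (n + m ^ suc (suc k) * c) ≡ quotientProduct k n mod m
    lower-factors = begin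
      quotientProduct k (n + m ^ suc (suc k) * c)
        ≡⟨ cong (λ t → quotientProduct k (n + t)) (m^[1+j]*c≡m^j*[m*c] (suc k) c) ⟩
      quotientProduct k (n + m ^ suc k * (m * c))
        ≈⟨ quotientProduct-shift k n (m * c) ⟩
      quotientProduct k n
        ∎
    last-factor : suc ((n + m ^ suc (suc k) * c) /m^ suc k) ≡ suc (n /m^ suc k) mod m
    last-factor = begin
      suc ((n + m ^ suc (suc k) * c) /m^ suc k)    ≡⟨ cong suc (/m^-shift (suc k) n c) ⟩
      suc (n /m^ suc k + m * c)                    ≡⟨ cong suc (cong (n /m^ suc k +_) (*-comm m c)) ⟩
      suc (n /m^ suc k) + c * m                    ≈⟨ +-multiple-mod _ c ⟩
      suc (n /m^ suc k)                            ∎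

  pM≡quotientProduct : ∀ k n → pM m n (suc k) ≡ quotientProduct k n mod m
  pM≡quotientProduct zero    n = ≡⇒≡-mod (pM-1 m n)
  pM≡quotientProduct (suc k) n = begin
    pM m n (suc (suc k))
      ≡⟨ sum-map-upTo _ (suc n) ⟩
    ∑[ x < suc n ] (if does (B * x ≤? n) then pM m (n ∸ B * x) (suc k) else 0)
      ≈⟨ ∑<-cong-mod (suc n) (λ {x} _ → summand x) ⟩
    ∑[ x < suc n ] (if does (B * x ≤? n) then quotientProduct k n else 0)
      ≡⟨ ∑<-if (λ x → B * x ≤? n) _ (suc n) ⟩
    count (suc n) (λ x → B * x ≤? n) * quotientProduct k n
      ≡⟨ cong (_* quotientProduct k n) (count-multiples-≤ B n) ⟩
    suc (n / B) * quotientProduct k n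
      ≡⟨ *-comm (suc (n / B)) _ ⟩
    quotientProduct (suc k) n
      ∎
    where
    open ≡-mod-Reasoning
    B : ℕ
    B = m ^ suc k
    instance
      B≢0 : NonZero B
      B≢0 = m^n≢0 m (suc k)
    summand : ∀ x → (if does (B * x ≤? n) then pM m (n ∸ B * x) (suc k) else 0)
                    ≡ (if does (B * x ≤? n) then quotientProduct k n else 0) mod m
    summand x = if-cong-mod (B * x ≤? n) λ Bx≤n → begin
      pM m (n ∸ B * x) (suc k)                  ≈⟨ pM≡quotientProduct k (n ∸ B * x) ⟩
      quotientProduct k (n ∸ B * x)             ≈⟨ ≡-mod-sym (quotientProduct-shift k (n ∸ B * x) x) ⟩
      quotientProduct k (n ∸ B * x + B * x)     ≡⟨ cong (quotientProduct k) (m∸n+n≡m Bx≤n) ⟩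
      quotientProduct k n                       ∎

  quotientProduct-leading-digit : ∀ L d x → x < m ^ suc L →
    quotientProduct (suc L) (d * m ^ suc L + x) ≡ quotientProduct L x * suc d mod m
  quotientProduct-leading-digit L d x x<B = *-cong-mod lower-factors (≡⇒≡-mod (cong suc leading-digit))
    where
    open ≡-mod-Reasoning
    leading-digit : (d * m ^ suc L + x) /m^ suc L ≡ d
    leading-digit = [d*B+x]/B≡d d (m ^ suc L) {{m^n≢0 m (suc L)}} x<B
    lower-factors : quotientProduct L (d * m ^ suc L + x) ≡ quotientProduct L x mod m
    lower-factors = begin
      quotientProduct L (d * m ^ suc L + x)    ≡⟨ cong (quotientProduct L) (+-comm (d * m ^ suc L) x) ⟩
      quotientProduct L (x + d * m ^ suc L)    ≡⟨ cong (λ t → quotientProduct L (x + t)) (*-comm d (m ^ suc L)) ⟩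
      quotientProduct L (x + m ^ suc L * d)    ≈⟨ quotientProduct-shift L x d ⟩
      quotientProduct L x                      ∎

  solutionCount : ℕ → ℕ → ℕ
  solutionCount L i = count (m ^ suc L) (λ n → quotientProduct L n % m ≟ i)

  numSolutions≡solutionCount : ∀ k i → numSolutions m i (suc k) ≡ solutionCount k i
  numSolutions≡solutionCount k i = begin
    numSolutions m i (suc k)
      ≡⟨ length-filter-upTo (λ n → pM m n (suc k) % m ≟ i) (m ^ suc k) ⟩
    count (m ^ suc k) (λ n → pM m n (suc k) % m ≟ i)
      ≡⟨ count-cong (λ n → pM m n (suc k) % m ≟ i) (λ n → quotientProduct k n % m ≟ i) (m ^ suc k)
                    (λ {n} _ → %≡-cong-mod (pM≡quotientProduct k n)) ⟩
    solutionCount k i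
      ∎
    where open ≡-Reasoning

  solutionCount-by-leading-digit : ∀ L i →
    solutionCount (suc L) i ≡ ∑[ d < m ] count (m ^ suc L) (λ x → quotientProduct L x * suc d % m ≟ i)
  solutionCount-by-leading-digit L i = trans (∑<-blocks _ m (m ^ suc L)) (∑<-cong m block)
    where
    block : ∀ {d} → d < m → count (m ^ suc L) (λ x → quotientProduct (suc L) (d * m ^ suc L + x) % m ≟ i)
                           ≡ count (m ^ suc L) (λ x → quotientProduct L x * suc d % m ≟ i)
    block {d} _ = count-cong (λ x → quotientProduct (suc L) (d * m ^ suc L + x) % m ≟ i)
                             (λ x → quotientProduct L x * suc d % m ≟ i) (m ^ suc L)
                             (λ {x} x<B → %≡-cong-mod (quotientProduct-leading-digit L d x x<B))

  solutionCount-suc : ∀ L {i} → 1 ≤ i →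
    solutionCount (suc L) i ≡ ∑[ d < m₁ ] count (m ^ suc L) (λ x → quotientProduct L x * suc d % m ≟ i)
  solutionCount-suc L {i} 1≤i = begin
    solutionCount (suc L) i                      ≡⟨ solutionCount-by-leading-digit L i ⟩
    unit-digits + count (m ^ suc L) top-digit    ≡⟨ cong (unit-digits +_) (count-none top-digit (m ^ suc L) no-solution) ⟩
    unit-digits + 0                              ≡⟨ +-identityʳ unit-digits ⟩
    unit-digits                                  ∎
    where
    open ≡-Reasoning
    unit-digits : ℕ
    unit-digits = ∑[ d < m₁ ] count (m ^ suc L) (λ x → quotientProduct L x * suc d % m ≟ i)
    top-digit : Decidable (λ x → quotientProduct L x * m % m ≡ i)
    top-digit x = quotientProduct L x * m % m ≟ i
    no-solution : ∀ {x} → x < m ^ suc L → quotientProduct L x * m % m ≢ i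
    no-solution {x} _ ≡i = <⇒≢ 1≤i (trans (sym (m*n%n≡0 (quotientProduct L x) m)) ≡i)

  solutionCount-one : ∀ {i} → 1 ≤ i → i < m → solutionCount 1 i ≡ m ^ 1
  solutionCount-one {suc i′} 1≤i i<m = begin
    solutionCount 1 (suc i′)                                   ≡⟨ solutionCount-suc 0 1≤i ⟩
    ∑[ d < m₁ ] count (m ^ 1) (λ _ → 1 * suc d % m ≟ suc i′)   ≡⟨ ∑<-cong m₁ digit-count ⟩
    ∑[ d < m₁ ] (m ^ 1 * indicator (d ≟ i′))                   ≡⟨ ∑<-*ˡ (m ^ 1) (λ d → indicator (d ≟ i′)) m₁ ⟩
    m ^ 1 * count m₁ (_≟ i′)                                   ≡⟨ cong (m ^ 1 *_) (count-≟ i′ m₁ (≤-pred i<m)) ⟩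
    m ^ 1 * 1                                                  ≡⟨ *-identityʳ (m ^ 1) ⟩
    m ^ 1                                                      ∎
    where
    open ≡-Reasoning
    digit⇔ : ∀ {d} → d < m₁ → (1 * suc d % m ≡ suc i′) ⇔ (d ≡ i′)
    digit⇔ {d} d<m₁ rewrite *-identityˡ (suc d) | m<n⇒m%n≡m (s≤s d<m₁) = mk⇔ suc-injective (cong suc)
    digit-count : ∀ {d} → d < m₁ →
                  count (m ^ 1) (λ _ → 1 * suc d % m ≟ suc i′) ≡ m ^ 1 * indicator (d ≟ i′)
    digit-count {d} d<m₁ =
      ∑<-const _ (m ^ 1) (λ _ → indicator-cong (1 * suc d % m ≟ suc i′) (d ≟ i′) (digit⇔ d<m₁))

  solutionCount-formula : Prime m → ∀ L {i} → 1 ≤ i → i < m → solutionCount (suc L) i ≡ m * m₁ ^ L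
  solutionCount-formula pm zero    1≤i i<m = solutionCount-one 1≤i i<m
  solutionCount-formula pm (suc L) {i} 1≤i i<m = begin
    solutionCount (suc (suc L)) i
      ≡⟨ solutionCount-suc (suc L) 1≤i ⟩
    ∑[ d < m₁ ] count (m ^ suc (suc L)) (λ x → quotientProduct (suc L) x * suc d % m ≟ i)
      ≡⟨ ∑<-const (m * m₁ ^ L) m₁ unit-digit ⟩
    m₁ * (m * m₁ ^ L)
      ≡⟨ x∙yz≈y∙xz m₁ m (m₁ ^ L) ⟩
    m * m₁ ^ suc L
      ∎
    where
    open ≡-Reasoning
    unit-digit : ∀ {d} → d < m₁ →
                 count (m ^ suc (suc L)) (λ x → quotientProduct (suc L) x * suc d % m ≟ i) ≡ m * m₁ ^ L
    unit-digit {d} d<m₁ with ∃-quotient-mod pm (suc d) (s≤s d<m₁) 1≤i i<m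
    ... | j , 1≤j , j<m , solution⇔ = begin
      count (m ^ suc (suc L)) (λ x → quotientProduct (suc L) x * suc d % m ≟ i)
        ≡⟨ count-cong (λ x → quotientProduct (suc L) x * suc d % m ≟ i) (λ x → quotientProduct (suc L) x % m ≟ j)
                      (m ^ suc (suc L)) (λ {x} _ → solution⇔ (quotientProduct (suc L) x)) ⟩
      solutionCount (suc L) j
        ≡⟨ solutionCount-formula pm L 1≤j j<m ⟩
      m * m₁ ^ L
        ∎

corollary6p3 : ((m : ℕ) → (pm : Prime m) → (i : ℕ) → 1 ≤ i → i < m → (k : ℕ) → 2 ≤ k →
    numSolutions m {{prime⇒nonZero pm}} i k ≡ m * (m ∸ 1) ^ (k ∸ 2))
    × ((m : ℕ) → Prime m → (n : ℕ) → pM m n 1 ≡ 1)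
corollary6p3 = numSolutions-formula , λ m _ n → pM-1 m n
  where
  numSolutions-formula : (m : ℕ) → (pm : Prime m) → (i : ℕ) → 1 ≤ i → i < m → (k : ℕ) → 2 ≤ k →
                         numSolutions m {{prime⇒nonZero pm}} i k ≡ m * (m ∸ 1) ^ (k ∸ 2)
  numSolutions-formula zero     pm with () ← nonTrivial⇒n>1 0 {{prime⇒nonTrivial pm}}
  numSolutions-formula (suc m₁) pm i 1≤i i<m 1             (s≤s ())
  numSolutions-formula (suc m₁) pm i 1≤i i<m (suc (suc k)) _ =
    trans (numSolutions≡solutionCount m₁ (suc k) i) (solutionCount-formula m₁ pm k 1≤i i<m)
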